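{- Let $b\ge3$ be an integer and define $(g_{1,b}(n))_{n\in\mathbb{N}}$ by $g_{1,b}(n)=0$ for integers $n<0$, $g_{1,b}(0)=1$, $g_{1,b}(1)=b$, and $g_{1,b}(n)=g_{1,b}(n-g_{1,b}(n-1))+g_{1,b}(n-2)$ for $n>1$. Then for all $n\in\mathbb{N}$, $$g_{1,b}(2n)=\begin{cases}1&\text{if }n<b-1,\\ 2&\text{if }n\ge b-1,\end{cases}\qquad g_{1,b}(2n+1)=\begin{cases}b+n&\text{if }n<b-1,\\ 2^{n-b+3}(b-1)&\text{if }n\ge b-1.\end{cases}$$ -}

module Defs where

open import Data.Nat using (ℕ)
open import Data.Integer using (ℤ; +_; _+_; _-_; _<_)
open import Data.Product using (_×_)
open import Relation.Binary.PropositionalEquality using (_≡_)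

IsG1 : ℕ → (ℤ → ℤ) → Set
IsG1 b g =
  (∀ n → n < + 0 → g n ≡ + 0) ×
  (g (+ 0) ≡ + 1) ×
  (g (+ 1) ≡ + b) ×
  (∀ n → + 1 < n → g n ≡ g (n - g (n - + 1)) + g (n - + 2))

-- Write a = b − 1. Away from the switch index n = a − 1, the value g(2n+1) exceeds 2n+2,
-- so the even recursion g(2n+2) = g(2n+2 − g(2n+1)) + g(2n) reads a negative index and
-- just copies g(2n); at the switch g(2n+1) = 2n+2 exactly, the lookup hits g(0) = 1 and the
-- even value steps from 1 to 2. The odd recursion g(2n+3) = g(2n+3 − g(2n+2)) + g(2n+1)
-- then adds g(2n+2) = 1 while the even value is 1 and doubles g(2n+1) once it is 2.
-- Interleaving these closed forms gives a solution, and induction on n shows every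
-- solution equals it.

module Submission where

open import Defs
open import Data.Nat using (ℕ; zero; suc; _≤_; _<_; _*_; _^_; _∸_; _+_; z≤n; s≤s; s≤s⁻¹; z<s; _<ᵇ_)
open import Data.Nat.Properties
open import Data.Nat.Tactic.RingSolver using (solve-∀)
open import Data.Integer using (ℤ; +_; -[1+_]; -_; +<+)
  renaming (_+_ to _+ℤ_; _-_ to _-ℤ_; _<_ to _<ℤ_)
import Data.Integer.Properties as ℤ
open import Data.Bool using (if_then_else_; true; false)
open import Data.Product using (_×_; Σ; ∃; _,_; proj₁; proj₂)
open import Data.Sum using (_⊎_; inj₁; inj₂)
open import Function using (_∘_)
open import Relation.Binary using (Tri; tri<; tri≈; tri>)
open import Relation.Binary.PropositionalEquality
open import Relation.Nullary using (contradiction; ofʸ; ofⁿ)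

interleave : {A : Set} → (ℕ → A) → (ℕ → A) → ℕ → A
interleave e o zero          = e 0
interleave e o (suc zero)    = o 0
interleave e o (suc (suc k)) = interleave (e ∘ suc) (o ∘ suc) k

interleave-even : {A : Set} (e o : ℕ → A) (n : ℕ) → interleave e o (2 * n) ≡ e n
interleave-even e o zero = refl
interleave-even e o (suc n) =
  trans (cong (interleave e o) (*-suc 2 n)) (interleave-even (e ∘ suc) (o ∘ suc) n)

interleave-odd : {A : Set} (e o : ℕ → A) (n : ℕ) → interleave e o (1 + 2 * n) ≡ o n
interleave-odd e o zero = refl
interleave-odd e o (suc n) =
  trans (cong (interleave e o ∘ suc) (*-suc 2 n)) (interleave-odd (e ∘ suc) (o ∘ suc) n)

even-or-odd : ∀ k → ∃ (λ n → k ≡ 2 * n) ⊎ ∃ (λ n → k ≡ 1 + 2 * n)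
even-or-odd zero = inj₁ (0 , refl)
even-or-odd (suc k) with even-or-odd k
... | inj₁ (n , refl) = inj₂ (n , refl)
... | inj₂ (n , refl) = inj₁ (suc n , sym (*-suc 2 n))

if-< : ∀ {A : Set} {m n} {x y : A} → m < n → (if m <ᵇ n then x else y) ≡ x
if-< {m = m} {n} m<n with m <ᵇ n | <ᵇ-reflects-< m n
... | true  | _        = refl
... | false | ofⁿ m≮n = contradiction m<n m≮n

if-≥ : ∀ {A : Set} {m n} {x y : A} → n ≤ m → (if m <ᵇ n then x else y) ≡ y
if-≥ {m = m} {n} n≤m with m <ᵇ n | <ᵇ-reflects-< m n
... | true  | ofʸ m<n = contradiction m<n (≤⇒≯ n≤m)
... | false | _       = refl

m-n<0 : ∀ {m n} → m < n → + m -ℤ + n <ℤ + 0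
m-n<0 {m} {n} m<n =
  subst (+ m -ℤ + n <ℤ_) (ℤ.+-inverseʳ (+ n)) (ℤ.+-monoˡ-< (- + n) (+<+ m<n))

recurrence : (ℤ → ℤ) → ℤ → ℤ
recurrence g n = g (n -ℤ g (n -ℤ + 1)) +ℤ g (n -ℤ + 2)

evenTerm : ℕ → ℕ → ℕ
evenTerm a n = if n <ᵇ a then 1 else 2

oddTerm : ℕ → ℕ → ℕ
oddTerm a n = if n <ᵇ a then suc a + n else 2 ^ (2 + (n ∸ a)) * a

evenTerm-< : ∀ {a n} → n < a → evenTerm a n ≡ 1
evenTerm-< = if-<

evenTerm-≥ : ∀ {a n} → a ≤ n → evenTerm a n ≡ 2
evenTerm-≥ = if-≥

oddTerm-< : ∀ {a n} → n < a → oddTerm a n ≡ suc a + n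
oddTerm-< = if-<

oddTerm-≥ : ∀ {a n} → a ≤ n → oddTerm a n ≡ 2 ^ (2 + (n ∸ a)) * a
oddTerm-≥ = if-≥

oddTerm-0 : ∀ {a} → 0 < a → oddTerm a 0 ≡ suc a
oddTerm-0 {a} 0<a = trans (oddTerm-< 0<a) (+-identityʳ (suc a))

early-gap : ∀ {a n} → suc n < a → 2 + 2 * n < suc a + n
early-gap {a} {n} n+1<a = begin-strict
  2 + 2 * n      ≡⟨ cong (λ m → 2 + (n + m)) (+-identityʳ n) ⟩
  2 + n + n      <⟨ +-monoˡ-< n (s≤s n+1<a) ⟩
  suc a + n      ∎
  where open ≤-Reasoning

oddTerm-switch : ∀ n → oddTerm (suc n) n ≡ 2 + 2 * n
oddTerm-switch n = trans (oddTerm-< (n<1+n n)) (cong (λ m → 2 + (n + m)) (sym (+-identityʳ n)))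

n<2^n : ∀ n → n < 2 ^ n
n<2^n zero    = z<s
n<2^n (suc n) = begin
  2 + n          ≤⟨ +-mono-≤ (m^n>0 2 n) (n<2^n n) ⟩
  2 ^ n + 2 ^ n  ≡⟨ cong (λ m → 2 ^ n + m) (sym (+-identityʳ (2 ^ n))) ⟩
  2 ^ suc n      ∎
  where open ≤-Reasoning

late-gap : ∀ {a n} → 2 ≤ a → a ≤ n → 2 + 2 * n < 2 ^ (2 + (n ∸ a)) * a
late-gap {a@(suc (suc c))} {n} (s≤s (s≤s z≤n)) a≤n =
  subst (λ m → 2 + 2 * m < 2 ^ (2 + t) * a) (m∸n+n≡m a≤n) (begin
    3 + 2 * (t + a)                                    ≤⟨ m≤m+n _ _ ⟩
    3 + 2 * (t + a) + (1 + 2 * c + 6 * t + 4 * t * c)  ≡⟨ expand c t ⟩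
    4 * (suc t * a)                                    ≤⟨ *-monoʳ-≤ 4 (*-monoˡ-≤ a (n<2^n t)) ⟩
    4 * (2 ^ t * a)                                    ≡⟨ sym (*-assoc 4 (2 ^ t) a) ⟩
    4 * 2 ^ t * a                                      ≡⟨ cong (_* a) (*-assoc 2 2 (2 ^ t)) ⟩
    2 ^ (2 + t) * a                                    ∎)
  where
  open ≤-Reasoning
  t = n ∸ a
  expand : ∀ c t → 3 + 2 * (t + (2 + c)) + (1 + 2 * c + 6 * t + 4 * t * c) ≡ 4 * (suc t * (2 + c))
  expand = solve-∀

oddTerm-suc-early : ∀ {a n} → suc n < a → oddTerm a (suc n) ≡ 1 + oddTerm a n
oddTerm-suc-early {a} {n} n+1<a
  rewrite oddTerm-< n+1<a | oddTerm-< (<⇒≤ n+1<a) = +-suc (suc a) n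

oddTerm-suc-late : ∀ {a n} → a ≤ suc n → oddTerm a (suc n) ≡ oddTerm a n + oddTerm a n
oddTerm-suc-late {a} {n} a≤n+1 with m≤n⇒m<n∨m≡n a≤n+1
... | inj₂ refl rewrite oddTerm-≥ (≤-refl {suc n}) | n∸n≡0 n | oddTerm-< (n<1+n n) = double n
  where
  double : ∀ n → 4 * suc n ≡ (2 + n + n) + (2 + n + n)
  double = solve-∀
... | inj₁ (s≤s a≤n) rewrite oddTerm-≥ a≤n | oddTerm-≥ (m≤n⇒m≤1+n a≤n) | +-∸-assoc 1 a≤n =
  double (2 ^ (2 + (n ∸ a))) a
  where
  double : ∀ p a → 2 * p * a ≡ p * a + p * a
  double = solve-∀

odd-step : ∀ {g : ℤ → ℤ} a n →
  g (+ (2 + 2 * n)) ≡ + evenTerm a (suc n) → g (+ (1 + 2 * n)) ≡ + oddTerm a n →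
  recurrence g (+ (3 + 2 * n)) ≡ + oddTerm a (suc n)
odd-step {g} a n g-even g-odd with <-≤-connex (suc n) a
... | inj₁ n+1<a = begin
  recurrence g (+ (3 + 2 * n))
    ≡⟨ cong (λ i → g (+ (3 + 2 * n) -ℤ i) +ℤ g (+ (1 + 2 * n))) g-even′ ⟩
  g (+ (2 + 2 * n)) +ℤ g (+ (1 + 2 * n))
    ≡⟨ cong₂ _+ℤ_ g-even′ g-odd ⟩
  + (1 + oddTerm a n)
    ≡⟨ cong +_ (sym (oddTerm-suc-early n+1<a)) ⟩
  + oddTerm a (suc n) ∎
  where
  open ≡-Reasoning
  g-even′ : g (+ (2 + 2 * n)) ≡ + 1
  g-even′ = trans g-even (cong +_ (evenTerm-< n+1<a))
... | inj₂ a≤n+1 = begin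
  recurrence g (+ (3 + 2 * n))
    ≡⟨ cong (λ i → g (+ (3 + 2 * n) -ℤ i) +ℤ g (+ (1 + 2 * n))) g-even′ ⟩
  g (+ (1 + 2 * n)) +ℤ g (+ (1 + 2 * n))
    ≡⟨ cong₂ _+ℤ_ g-odd g-odd ⟩
  + (oddTerm a n + oddTerm a n)
    ≡⟨ cong +_ (sym (oddTerm-suc-late a≤n+1)) ⟩
  + oddTerm a (suc n) ∎
  where
  open ≡-Reasoning
  g-even′ : g (+ (2 + 2 * n)) ≡ + 2
  g-even′ = trans g-even (cong +_ (evenTerm-≥ a≤n+1))

even-step : ∀ {g : ℤ → ℤ} → (∀ i → i <ℤ + 0 → g i ≡ + 0) → g (+ 0) ≡ + 1 →
  ∀ {a} → 2 ≤ a → ∀ n →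
  g (+ (1 + 2 * n)) ≡ + oddTerm a n → g (+ (2 * n)) ≡ + evenTerm a n →
  recurrence g (+ (2 + 2 * n)) ≡ + evenTerm a (suc n)
even-step {g} g-neg g-0 {a} 2≤a n g-odd g-even = begin
  recurrence g (+ (2 + 2 * n))
    ≡⟨ cong₂ (λ i j → g (+ (2 + 2 * n) -ℤ i) +ℤ j) g-odd g-even ⟩
  g (+ (2 + 2 * n) -ℤ + oddTerm a n) +ℤ + evenTerm a n
    ≡⟨ by-cmp (<-cmp (suc n) a) ⟩
  + evenTerm a (suc n) ∎
  where
  open ≡-Reasoning
  by-cmp : Tri (suc n < a) (suc n ≡ a) (a < suc n) →
    g (+ (2 + 2 * n) -ℤ + oddTerm a n) +ℤ + evenTerm a n ≡ + evenTerm a (suc n)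
  by-cmp (tri< n+1<a _ _)
    rewrite oddTerm-< (<⇒≤ n+1<a) | evenTerm-< (<⇒≤ n+1<a) | evenTerm-< n+1<a =
    cong (_+ℤ + 1) (g-neg _ (m-n<0 (early-gap n+1<a)))
  by-cmp (tri≈ _ refl _)
    rewrite oddTerm-switch n | evenTerm-< (n<1+n n) | evenTerm-≥ (≤-refl {suc n})
          | ℤ.+-inverseʳ (+ (2 + 2 * n)) =
    cong (_+ℤ + 1) g-0
  by-cmp (tri> _ _ a<n+1)
    rewrite oddTerm-≥ (s≤s⁻¹ a<n+1) | evenTerm-≥ (s≤s⁻¹ a<n+1) | evenTerm-≥ (<⇒≤ a<n+1) =
    cong (_+ℤ + 2) (g-neg _ (m-n<0 (late-gap 2≤a (s≤s⁻¹ a<n+1))))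

closedForm : ℕ → ℤ → ℤ
closedForm a (+ k)     = + interleave (evenTerm a) (oddTerm a) k
closedForm a -[1+ _ ] = + 0

closedForm-even : ∀ a n → closedForm a (+ (2 * n)) ≡ + evenTerm a n
closedForm-even a n = cong +_ (interleave-even (evenTerm a) (oddTerm a) n)

closedForm-odd : ∀ a n → closedForm a (+ (1 + 2 * n)) ≡ + oddTerm a n
closedForm-odd a n = cong +_ (interleave-odd (evenTerm a) (oddTerm a) n)

closedForm-isG1 : ∀ {a} → 2 ≤ a → IsG1 (suc a) (closedForm a)
closedForm-isG1 {a} 2≤a = negative , zeroth , first , recursion
  where
  0<a : 0 < a
  0<a = <-≤-trans z<s 2≤a
  negative : ∀ i → i <ℤ + 0 → closedForm a i ≡ + 0
  negative -[1+ _ ] _       = refl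
  negative (+ _)    (+<+ ())
  zeroth : closedForm a (+ 0) ≡ + 1
  zeroth = cong +_ (evenTerm-< 0<a)
  first : closedForm a (+ 1) ≡ + suc a
  first = cong +_ (oddTerm-0 0<a)
  even-suc : ∀ n → closedForm a (+ (2 + 2 * n)) ≡ + evenTerm a (suc n)
  even-suc = cong +_ ∘ interleave-even (evenTerm a ∘ suc) (oddTerm a ∘ suc)
  odd-suc : ∀ n → closedForm a (+ (3 + 2 * n)) ≡ + oddTerm a (suc n)
  odd-suc = cong +_ ∘ interleave-odd (evenTerm a ∘ suc) (oddTerm a ∘ suc)
  recursion : ∀ i → + 1 <ℤ i → closedForm a i ≡ recurrence (closedForm a) i
  recursion (+ 0)           (+<+ ())
  recursion (+ 1)           (+<+ (s≤s ()))
  recursion (+ suc (suc k)) _ with even-or-odd k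
  ... | inj₁ (n , refl) =
    trans (even-suc n) (sym (even-step negative zeroth 2≤a n (closedForm-odd a n) (closedForm-even a n)))
  ... | inj₂ (n , refl) =
    trans (odd-suc n) (sym (odd-step {closedForm a} a n (even-suc n) (closedForm-odd a n)))

closedForm-unique : ∀ {a} → 2 ≤ a → ∀ {g} → IsG1 (suc a) g → ∀ n →
  g (+ (2 * n)) ≡ + evenTerm a n × g (+ (1 + 2 * n)) ≡ + oddTerm a n
closedForm-unique {a} 2≤a (_ , g-0 , g-1 , _) zero =
  trans g-0 (cong +_ (sym (evenTerm-< 0<a))) , trans g-1 (cong +_ (sym (oddTerm-0 0<a)))
  where
  0<a : 0 < a
  0<a = <-≤-trans z<s 2≤a
closedForm-unique {a} 2≤a {g} G@(g-neg , g-0 , _ , g-rec) (suc n) =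
  trans (cong (g ∘ +_) (*-suc 2 n)) g-even , trans (cong (g ∘ +_ ∘ suc) (*-suc 2 n)) g-odd
  where
  ih = closedForm-unique 2≤a G n
  g-even : g (+ (2 + 2 * n)) ≡ + evenTerm a (suc n)
  g-even = trans (g-rec _ (+<+ (s≤s (s≤s z≤n)))) (even-step g-neg g-0 2≤a n (proj₂ ih) (proj₁ ih))
  g-odd : g (+ (3 + 2 * n)) ≡ + oddTerm a (suc n)
  g-odd = trans (g-rec _ (+<+ (s≤s (s≤s z≤n)))) (odd-step {g} a n g-even (proj₂ ih))

exponent-shift : ∀ {a n} → a ≤ n → n + 3 ∸ suc a ≡ 2 + (n ∸ a)
exponent-shift {a} {n} a≤n = trans (cong (_∸ suc a) (+-comm n 3)) (+-∸-assoc 2 a≤n)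

theorem6p6 : ∀ (b : ℕ) → 3 ≤ b →
    Σ (ℤ → ℤ) (IsG1 b) ×
    (∀ (g : ℤ → ℤ) → IsG1 b g → ∀ (n : ℕ) →
      (n < b ∸ 1 → g (+ (2 * n)) ≡ + 1) ×
      (b ∸ 1 ≤ n → g (+ (2 * n)) ≡ + 2) ×
      (n < b ∸ 1 → g (+ (2 * n + 1)) ≡ + (b + n)) ×
      (b ∸ 1 ≤ n → g (+ (2 * n + 1)) ≡ + (2 ^ (n + 3 ∸ b) * (b ∸ 1))))
theorem6p6 (suc a) (s≤s 2≤a) = (closedForm a , closedForm-isG1 2≤a) , λ g G n →
  let (even , odd) = closedForm-unique 2≤a G n
      odd′ = trans (cong (g ∘ +_) (+-comm (2 * n) 1)) odd
  in (λ n<a → trans even (cong +_ (evenTerm-< n<a)))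
   , (λ a≤n → trans even (cong +_ (evenTerm-≥ a≤n)))
   , (λ n<a → trans odd′ (cong +_ (oddTerm-< n<a)))
   , (λ a≤n → trans odd′ (cong +_ (trans (oddTerm-≥ a≤n) (cong (λ e → 2 ^ e * a) (sym (exponent-shift a≤n))))))
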